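{- Let $\mathcal{F}$ be the family of finite hypergraphs of VC-dimension 1. Then: (i) for every integer $r\ge 1$, every $H\in\mathcal{F}$ all of whose hyperedges have at least $r$ vertices satisfies $\mathsf{p}(H)\ge\lceil r/2\rceil$, and some such $H\in\mathcal{F}$ has $\mathsf{p}(H)=\lceil r/2\rceil$; (ii) for every integer $\delta\ge 1$, every $H\in\mathcal{F}$ with minimum degree at least $\delta$ satisfies $\mathsf{p}'(H)\ge\lceil\delta/2\rceil$, and some such $H\in\mathcal{F}$ has $\mathsf{p}'(H)=\lceil\delta/2\rceil$.
   Context: A hypergraph $H=(V,\mathcal{E})$ has finite vertex set $V$ and a finite multiset $\mathcal{E}$ of subsets of $V$. A set $S\subseteq V$ is shattered if $\{S\cap E: E\in\mathcal{E}\}$ is the set of all subsets of $S$; the VC-dimension of $H$ is the largest size of a shattered set. The degree of a vertex is the number of hyperedges containing it. A polychromatic $k$-colouring is a map $V\to\{1,\dots,k\}$ such that every hyperedge contains a vertex of every colour; $\mathsf{p}(H)$ is the maximum such $k$. A set cover is a subfamily of $\mathcal{E}$ with union $V$; $\mathsf{p}'(H)$ is the maximum $k$ such that $\mathcal{E}$ can be partitioned into $k$ set covers. -}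

module Defs where

open import Data.Nat using (ℕ; _≤_; ⌈_/2⌉)
open import Data.Fin using (Fin)
open import Data.Fin.Subset using (Subset; _∈_; _⊆_; _∩_; ∣_∣)
open import Data.Vec using (tabulate; lookup)
open import Data.Product using (Σ; ∃; _×_)
open import Relation.Binary.PropositionalEquality using (_≡_)

-- A hypergraph with vertex set Fin n and a multiset of m hyperedges,
-- given as an indexed family (repetitions allowed).
record Hypergraph : Set where
  constructor hypergraph
  field
    n : ℕ
    m : ℕ
    edge : Fin m → Subset n
open Hypergraph public

Shattered : (H : Hypergraph) → Subset (n H) → Set
Shattered H S = ∀ (T : Subset (n H)) → T ⊆ S → ∃ λ (e : Fin (m H)) → S ∩ edge H e ≡ T

VCdim : Hypergraph → ℕ → Set
VCdim H d = (∃ λ S → Shattered H S × ∣ S ∣ ≡ d)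
          × (∀ S → Shattered H S → ∣ S ∣ ≤ d)

degree : (H : Hypergraph) → Fin (n H) → ℕ
degree H v = ∣ tabulate (λ e → lookup (edge H e) v) ∣

EdgesAtLeast : Hypergraph → ℕ → Set
EdgesAtLeast H r = ∀ e → r ≤ ∣ edge H e ∣

MinDegAtLeast : Hypergraph → ℕ → Set
MinDegAtLeast H δ = ∀ v → δ ≤ degree H v

Polychromatic : (H : Hypergraph) (k : ℕ) → (Fin (n H) → Fin k) → Set
Polychromatic H k c = ∀ e (i : Fin k) → ∃ λ v → v ∈ edge H e × c v ≡ i

HasPoly : Hypergraph → ℕ → Set
HasPoly H k = Σ (Fin (n H) → Fin k) (Polychromatic H k)

pAtLeast : Hypergraph → ℕ → Set
pAtLeast H k = ∃ λ j → k ≤ j × HasPoly H j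

pEquals : Hypergraph → ℕ → Set
pEquals H k = HasPoly H k × (∀ j → HasPoly H j → j ≤ k)

-- partition of the hyperedges into k classes (f e = class of e), each a set cover
CoverPartition : (H : Hypergraph) (k : ℕ) → (Fin (m H) → Fin k) → Set
CoverPartition H k f = ∀ (i : Fin k) (v : Fin (n H)) → ∃ λ e → f e ≡ i × v ∈ edge H e

HasCoverPartition : Hypergraph → ℕ → Set
HasCoverPartition H k = Σ (Fin (m H) → Fin k) (CoverPartition H k)

p'AtLeast : Hypergraph → ℕ → Set
p'AtLeast H k = ∃ λ j → k ≤ j × HasCoverPartition H j

p'Equals : Hypergraph → ℕ → Set
p'Equals H k = HasCoverPartition H k × (∀ j → HasCoverPartition H j → j ≤ k)

module Submission where

-- Both lower bounds are one "peeling" induction on an incidence structure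
-- rows : Fin M → Subset N (hyperedges as vertex sets for p, vertex stars as
-- hyperedge sets for p').  If every row has at least d + 3 items in the
-- current ground set W, take a minimal set T hitting every row inside W.
-- Unless some row is crowded (three of its items in T, at most d left in
-- W ─ T), every row keeps d + 1 items of W ─ T; so T is a colour class and
-- recursion on W ─ T yields 1 + ⌈ (d+1)/2 ⌉ = ⌈ (d+3)/2 ⌉ classes.
-- VC-dimension one means that no pair of points is shattered, and this
-- excludes crowded rows: for hyperedges via the private hyperedges of three
-- transversal vertices, for stars via the private vertices of three cover
-- edges together with hyperedges escaping the sparse star.
-- Both bounds are attained by the hypergraph of all complements of
-- singletons of an (r+1)-set: it has VC-dimension one, and every class of a
-- polychromatic colouring or of a cover partition has two elements.

open import Defs
open import Data.Nat using (ℕ; _≤_; ⌈_/2⌉; zero; suc; _+_; _∸_; z≤n; s≤s; _≤?_)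
open import Data.Nat.Properties
  using (≤-refl; ≤-trans; ≤-reflexive; ≤-pred; ≰⇒>; +-suc; +-monoˡ-≤; +-monoʳ-≤; +-cancelʳ-≤;
         n≡⌊n+n/2⌋; ⌊n/2⌋-mono; module ≤-Reasoning)
open import Data.Bool using (if_then_else_)
open import Data.Bool.Properties using (∧-zeroʳ)
open import Data.Empty using (⊥; ⊥-elim)
open import Data.Fin using (Fin; zero; suc; splitAt; join)
open import Data.Fin.Properties using (_≟_; any?; all?; ¬∀⟶∃¬; injective⇒≤; join-splitAt; 0≢1+n)
open import Data.Fin.Subset
  using (Subset; inside; outside; _∈_; _∉_; _⊆_; _∩_; _∪_; _─_; _-_; ∁; ⁅_⁆; ∣_∣; Nonempty; ⊤)
  renaming (⊥ to ∅)
open import Data.Fin.Subset.Properties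
  using (_∈?_; nonempty?; x∈p∩q⁺; x∈p∩q⁻; p∩q⊆p; x∈p∪q⁺; x∈p∪q⁻; ∩-identityʳ; ⊆-antisym;
         ∉⊥; ⊥⊆; x∈⁅x⁆; x∈⁅y⁆⇒x≡y; x≢y⇒x∉⁅y⁆; x∉⁅y⁆⇒x≢y; x∈∁p⇒x∉p; x∉p⇒x∈∁p;
         ∣⁅x⁆∣≡1; ∣∁p∣≡n∸∣p∣; ∣p∩q∣≤∣q∣; p⊆q⇒∣p∣≤∣q∣; x∈p⇒∣p-x∣<∣p∣;
         x∈p∧x∉q⇒x∈p─q; x∈p∧x≢y⇒x∈p-y)
open import Data.Product using (∃; _×_; Σ; _,_; proj₁; proj₂)
open import Data.Sum using (_⊎_; inj₁; inj₂; [_,_]′)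
open import Data.Vec using (_∷_; []; here; there; lookup; tabulate)
open import Data.Vec.Properties using (lookup∘tabulate; []=⇒lookup; lookup⇒[]=)
open import Function using (id; case_of_)
open import Relation.Nullary using (¬_; Dec; yes; no; does; ¬?)
open import Relation.Nullary.Decidable using (_×-dec_; dec-true; dec-false)
open import Relation.Binary.PropositionalEquality
  using (_≡_; _≢_; refl; sym; trans; cong; cong₂; subst)

private
  variable
    N : ℕ

size-nonempty : ∀ {p : Subset N} → 1 ≤ ∣ p ∣ → Nonempty p
size-nonempty {p = inside ∷ p} _ = zero , here
size-nonempty {p = outside ∷ p} size with size-nonempty size
... | x , x∈p = suc x , there x∈p

element-size : ∀ {p : Subset N} {x} → x ∈ p → 1 ≤ ∣ p ∣
element-size x∈p = ≤-trans (s≤s z≤n) (x∈p⇒∣p-x∣<∣p∣ x∈p)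

two-elements : ∀ {p : Subset N} {x y} → x ∈ p → y ∈ p → x ≢ y → 2 ≤ ∣ p ∣
two-elements x∈p y∈p x≢y =
  ≤-trans (s≤s (element-size (x∈p∧x≢y⇒x∈p-y y∈p (λ y≡x → x≢y (sym y≡x))))) (x∈p⇒∣p-x∣<∣p∣ x∈p)

∈─⁻ : ∀ {x : Fin N} (p q : Subset N) → x ∈ p ─ q → x ∈ p × x ∉ q
∈─⁻ (inside ∷ p) (outside ∷ q) here = here , λ ()
∈─⁻ {x = zero} (outside ∷ p) (inside ∷ q) ()
∈─⁻ {x = zero} (outside ∷ p) (outside ∷ q) ()
∈─⁻ (_ ∷ p) (_ ∷ q) (there x∈p─q) with ∈─⁻ p q x∈p─q
... | x∈p , x∉q = there x∈p , λ { (there x∈q) → x∉q x∈q }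

∈-remove⁻ : ∀ {x y : Fin N} (p : Subset N) → y ∈ p - x → y ∈ p × y ≢ x
∈-remove⁻ {x = x} p y∈p-x with ∈─⁻ p ⁅ x ⁆ y∈p-x
... | y∈p , y∉⁅x⁆ = y∈p , x∉⁅y⁆⇒x≢y y∉⁅x⁆

∈∩∩⁻ : ∀ {x : Fin N} (p q r : Subset N) → x ∈ (p ∩ q) ∩ r → x ∈ p × x ∈ q × x ∈ r
∈∩∩⁻ p q r x∈ with x∈p∩q⁻ (p ∩ q) r x∈
... | x∈p∩q , x∈r = proj₁ (x∈p∩q⁻ p q x∈p∩q) , proj₂ (x∈p∩q⁻ p q x∈p∩q) , x∈r

∣p∣≡∣p∩q∣+∣p─q∣ : ∀ (p q : Subset N) → ∣ p ∣ ≡ ∣ p ∩ q ∣ + ∣ p ─ q ∣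
∣p∣≡∣p∩q∣+∣p─q∣ [] [] = refl
∣p∣≡∣p∩q∣+∣p─q∣ (inside ∷ p) (inside ∷ q) = cong suc (∣p∣≡∣p∩q∣+∣p─q∣ p q)
∣p∣≡∣p∩q∣+∣p─q∣ (inside ∷ p) (outside ∷ q) =
  trans (cong suc (∣p∣≡∣p∩q∣+∣p─q∣ p q)) (sym (+-suc ∣ p ∩ q ∣ ∣ p ─ q ∣))
∣p∣≡∣p∩q∣+∣p─q∣ (outside ∷ p) (inside ∷ q) = ∣p∣≡∣p∩q∣+∣p─q∣ p q
∣p∣≡∣p∩q∣+∣p─q∣ (outside ∷ p) (outside ∷ q) = ∣p∣≡∣p∩q∣+∣p─q∣ p q

∩-─-assoc : ∀ (p q r : Subset N) → (p ∩ q) ─ r ≡ p ∩ (q ─ r)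
∩-─-assoc [] [] [] = refl
∩-─-assoc (a ∷ p) (_ ∷ q) (inside ∷ r) = cong₂ _∷_ (sym (∧-zeroʳ a)) (∩-─-assoc p q r)
∩-─-assoc (_ ∷ p) (_ ∷ q) (outside ∷ r) = cong (_ ∷_) (∩-─-assoc p q r)

∣p∣≤1+∣p-x∣ : ∀ (p : Subset N) x → ∣ p ∣ ≤ suc ∣ p - x ∣
∣p∣≤1+∣p-x∣ p x = begin
  ∣ p ∣                      ≡⟨ ∣p∣≡∣p∩q∣+∣p─q∣ p ⁅ x ⁆ ⟩
  ∣ p ∩ ⁅ x ⁆ ∣ + ∣ p - x ∣  ≤⟨ +-monoˡ-≤ ∣ p - x ∣ (≤-trans (∣p∩q∣≤∣q∣ p ⁅ x ⁆) (≤-reflexive (∣⁅x⁆∣≡1 x))) ⟩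
  suc ∣ p - x ∣              ∎
  where open ≤-Reasoning

remove-size : ∀ {k} (p : Subset N) x → suc k ≤ ∣ p ∣ → k ≤ ∣ p - x ∣
remove-size p x big = ≤-pred (≤-trans big (∣p∣≤1+∣p-x∣ p x))

record Triple (p : Subset N) : Set where
  field
    x y z : Fin N
    x∈p   : x ∈ p
    y∈p   : y ∈ p
    z∈p   : z ∈ p
    x≢y   : x ≢ y
    x≢z   : x ≢ z
    y≢z   : y ≢ z

triple : ∀ {p : Subset N} → 3 ≤ ∣ p ∣ → Triple p
triple {p = p} three with size-nonempty (≤-trans (s≤s z≤n) three)
... | x , x∈p with size-nonempty (≤-trans (s≤s z≤n) (remove-size p x three))
... | y , y∈p-x with size-nonempty (remove-size (p - x) y (remove-size p x three))
... | z , z∈p-x-y with ∈-remove⁻ p y∈p-x | ∈-remove⁻ (p - x) z∈p-x-y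
... | y∈p , y≢x | z∈p-x , z≢y with ∈-remove⁻ p z∈p-x
... | z∈p , z≢x = record
  { x = x ; y = y ; z = z ; x∈p = x∈p ; y∈p = y∈p ; z∈p = z∈p
  ; x≢y = λ x≡y → y≢x (sym x≡y) ; x≢z = λ x≡z → z≢x (sym x≡z) ; y≢z = λ y≡z → z≢y (sym y≡z) }

-- Minimal hitting sets of a family of rows

module Hitting {M N : ℕ} (rows : Fin M → Subset N) where

  Hits : Subset N → Set
  Hits T = ∀ j → Nonempty (rows j ∩ T)

  record PrivateRow (T : Subset N) (x : Fin N) : Set where
    field
      row    : Fin M
      member : x ∈ rows row
      unique : ∀ {y} → y ∈ rows row → y ∈ T → y ≡ x

  MinimalHitting : Subset N → Set
  MinimalHitting T = Hits T × (∀ {x} → x ∈ T → PrivateRow T x)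

  hits? : ∀ T → Dec (Hits T)
  hits? T = all? (λ j → nonempty? (rows j ∩ T))

  -- If no item can be dropped from the hitting set S, each item of S has a
  -- private row: a row left unhit once that item is dropped.
  irreducible⇒private : ∀ {S} → Hits S → ¬ (∃ λ x → x ∈ S × Hits (S - x)) →
                        ∀ {x} → x ∈ S → PrivateRow S x
  irreducible⇒private {S} hits irreducible {x} x∈S = record
    { row = j ; member = subst (_∈ rows j) (unique y∈row y∈S) y∈row ; unique = unique }
    where
    unhit : ∃ λ j → ¬ Nonempty (rows j ∩ (S - x))
    unhit = ¬∀⟶∃¬ M _ (λ j → nonempty? (rows j ∩ (S - x))) (λ h → irreducible (x , x∈S , h))
    j : Fin M
    j = proj₁ unhit
    unique : ∀ {y} → y ∈ rows j → y ∈ S → y ≡ x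
    unique {y} y∈row y∈S with y ≟ x
    ... | yes y≡x = y≡x
    ... | no y≢x = ⊥-elim (proj₂ unhit (y , x∈p∩q⁺ (y∈row , x∈p∧x≢y⇒x∈p-y y∈S y≢x)))
    y : Fin N
    y = proj₁ (hits j)
    y∈row : y ∈ rows j
    y∈row = proj₁ (x∈p∩q⁻ (rows j) S (proj₂ (hits j)))
    y∈S : y ∈ S
    y∈S = proj₂ (x∈p∩q⁻ (rows j) S (proj₂ (hits j)))

  -- Greedily drop items while the set still hits every row; k bounds ∣ S ∣.
  minimal-below : ∀ k S → ∣ S ∣ ≤ k → Hits S → ∃ MinimalHitting
  minimal-below zero S size hits =
    S , hits , irreducible⇒private hits λ (x , x∈S , _) →
      case ≤-trans (element-size x∈S) size of λ ()
  minimal-below (suc k) S size hits with any? (λ x → x ∈? S ×-dec hits? (S - x))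
  ... | yes (x , x∈S , hits′) =
    minimal-below k (S - x) (≤-pred (≤-trans (x∈p⇒∣p-x∣<∣p∣ x∈S) size)) hits′
  ... | no irreducible = S , hits , irreducible⇒private hits irreducible

  minimal-hitting-set : (∀ j → Nonempty (rows j)) → ∃ MinimalHitting
  minimal-hitting-set nonempty = minimal-below ∣ ⊤ {N} ∣ ⊤ ≤-refl
    (λ j → subst Nonempty (sym (∩-identityʳ (rows j))) (nonempty j))

-- Peeling: rainbow colourings of a family of rows

module Peeling {M N : ℕ} (rows : Fin M → Subset N) where

  open Hitting using (PrivateRow; MinimalHitting)
  open PrivateRow

  restrict : Subset N → Fin M → Subset N
  restrict W j = rows j ∩ W

  Rainbow : ∀ {k} → Subset N → (Fin N → Fin k) → Set
  Rainbow W c = ∀ j i → ∃ λ x → x ∈ rows j ∩ W × c x ≡ i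

  Peelable : Set
  Peelable = ∀ d W → (∀ j → 3 + d ≤ ∣ rows j ∩ W ∣) →
    ∃ λ T → (∀ j → Nonempty ((rows j ∩ W) ∩ T)) × (∀ j → suc d ≤ ∣ rows j ∩ (W ─ T) ∣)

  one-colour : ∀ {W} → (∀ j → Nonempty (rows j ∩ W)) → Rainbow W (λ _ → zero {0})
  one-colour nonempty j zero = proj₁ (nonempty j) , proj₂ (nonempty j) , refl

  extend : ∀ {k} → Subset N → (Fin N → Fin k) → Fin N → Fin (suc k)
  extend T c x = if does (x ∈? T) then zero else suc (c x)

  extend-rainbow : ∀ {k W T} {c : Fin N → Fin k} → (∀ j → Nonempty ((rows j ∩ W) ∩ T)) →
                   Rainbow (W ─ T) c → Rainbow W (extend T c)
  extend-rainbow {W = W} {T} {c} hits rainbow j zero with hits j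
  ... | x , x∈ with x∈p∩q⁻ (rows j ∩ W) T x∈
  ... | x∈row∩W , x∈T =
    x , x∈row∩W , cong (λ b → if b then zero else suc (c x)) (dec-true (x ∈? T) x∈T)
  extend-rainbow {W = W} {T} {c} hits rainbow j (suc i) with rainbow j i
  ... | x , x∈ , cx≡i with x∈p∩q⁻ (rows j) (W ─ T) x∈
  ... | x∈row , x∈W─T with ∈─⁻ W T x∈W─T
  ... | x∈W , x∉T =
    x , x∈p∩q⁺ (x∈row , x∈W) ,
    trans (cong (λ b → if b then zero else suc (c x)) (dec-false (x ∈? T) x∉T)) (cong suc cx≡i)

  rainbow-colouring : Peelable → ∀ d W → (∀ j → suc d ≤ ∣ rows j ∩ W ∣) →
                      Σ (Fin N → Fin ⌈ suc d /2⌉) (Rainbow W)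
  rainbow-colouring peel zero W big = _ , one-colour (λ j → size-nonempty (big j))
  rainbow-colouring peel (suc zero) W big =
    _ , one-colour (λ j → size-nonempty (≤-trans (s≤s z≤n) (big j)))
  rainbow-colouring peel (suc (suc d)) W big with peel d W big
  ... | T , hits , rest with rainbow-colouring peel d (W ─ T) rest
  ... | c , rainbow = extend T c , extend-rainbow hits rainbow

  Crowded : ℕ → Subset N → Subset N → Fin M → Set
  Crowded d W T j = Triple ((rows j ∩ W) ∩ T) × ∣ rows j ∩ (W ─ T) ∣ ≤ d

  NeverCrowded : Set
  NeverCrowded = ∀ d W T → (∀ j → 3 + d ≤ ∣ rows j ∩ W ∣) →
                 MinimalHitting (restrict W) T → ∀ j → ¬ Crowded d W T j

  row-split : ∀ W T j → ∣ rows j ∩ W ∣ ≡ ∣ (rows j ∩ W) ∩ T ∣ + ∣ rows j ∩ (W ─ T) ∣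
  row-split W T j = trans (∣p∣≡∣p∩q∣+∣p─q∣ (rows j ∩ W) T)
                          (cong (λ s → ∣ (rows j ∩ W) ∩ T ∣ + ∣ s ∣) (∩-─-assoc (rows j) W T))

  peelable : NeverCrowded → Peelable
  peelable never d W big with Hitting.minimal-hitting-set (restrict W)
                                (λ j → size-nonempty (≤-trans (s≤s z≤n) (big j)))
  ... | T , minimal = T , proj₁ minimal , remains
    where
    remains : ∀ j → suc d ≤ ∣ rows j ∩ (W ─ T) ∣
    remains j with suc d ≤? ∣ rows j ∩ (W ─ T) ∣
    ... | yes enough = enough
    ... | no few = ⊥-elim (never d W T big minimal j (triple three-in-T , sparse))
      where
      open ≤-Reasoning
      sparse : ∣ rows j ∩ (W ─ T) ∣ ≤ d
      sparse = ≤-pred (≰⇒> few)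
      three-in-T : 3 ≤ ∣ (rows j ∩ W) ∩ T ∣
      three-in-T = +-cancelʳ-≤ d 3 _ (begin
        3 + d                                              ≤⟨ big j ⟩
        ∣ rows j ∩ W ∣                                     ≡⟨ row-split W T j ⟩
        ∣ (rows j ∩ W) ∩ T ∣ + ∣ rows j ∩ (W ─ T) ∣       ≤⟨ +-monoʳ-≤ _ sparse ⟩
        ∣ (rows j ∩ W) ∩ T ∣ + d                           ∎)

  private-member : ∀ {W T x} (π : PrivateRow (restrict W) T x) → x ∈ rows (row π)
  private-member {W} π = proj₁ (x∈p∩q⁻ (rows (row π)) W (member π))

  private-excludes : ∀ {W T x y} (π : PrivateRow (restrict W) T x) →
                     y ∈ W → y ∈ T → y ≢ x → y ∉ rows (row π)
  private-excludes π y∈W y∈T y≢x y∈row = y≢x (unique π (x∈p∩q⁺ (y∈row , y∈W)) y∈T)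

  -- A private row is not contained in a sparse row: otherwise that row would
  -- keep all of its ≥ d + 2 items of W other than x in W ─ T.
  private-row-escapes : ∀ {d W T x j} → (∀ j → 3 + d ≤ ∣ rows j ∩ W ∣) →
                        (π : PrivateRow (restrict W) T x) → ∣ rows j ∩ (W ─ T) ∣ ≤ d →
                        ∃ λ y → y ∈ rows (row π) × y ∉ rows j
  private-row-escapes {d} {W} {T} {x} {j} big π sparse
    with any? (λ y → y ∈? rows (row π) ×-dec ¬? (y ∈? rows j))
  ... | yes escape = escape
  ... | no inside-j = case +-cancelʳ-≤ d 3 1 (≤-trans (big (row π)) too-few) of λ { (s≤s ()) }
    where
    open ≤-Reasoning
    others-remain : (rows (row π) ∩ W) - x ⊆ rows j ∩ (W ─ T)
    others-remain {y} y∈ with ∈-remove⁻ (rows (row π) ∩ W) y∈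
    ... | y∈row∩W , y≢x with x∈p∩q⁻ (rows (row π)) W y∈row∩W | y ∈? rows j | y ∈? T
    ... | y∈row , y∈W | no y∉rowj | _ = ⊥-elim (inside-j (y , y∈row , y∉rowj))
    ... | _ | _ | yes y∈T = ⊥-elim (y≢x (unique π y∈row∩W y∈T))
    ... | y∈row , y∈W | yes y∈rowj | no y∉T = x∈p∩q⁺ (y∈rowj , x∈p∧x∉q⇒x∈p─q y∈W y∉T)
    too-few : ∣ rows (row π) ∩ W ∣ ≤ suc d
    too-few = begin
      ∣ rows (row π) ∩ W ∣             ≤⟨ ∣p∣≤1+∣p-x∣ (rows (row π) ∩ W) x ⟩
      suc ∣ (rows (row π) ∩ W) - x ∣   ≤⟨ s≤s (p⊆q⇒∣p∣≤∣q∣ others-remain) ⟩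
      suc ∣ rows j ∩ (W ─ T) ∣         ≤⟨ s≤s sparse ⟩
      suc d                            ∎

-- VC-dimension one: no shattered pair

record ShattersPair (H : Hypergraph) (x y : Fin (n H)) : Set where
  field
    both    : ∃ λ e → x ∈ edge H e × y ∈ edge H e
    onlyˡ   : ∃ λ e → x ∈ edge H e × y ∉ edge H e
    onlyʳ   : ∃ λ e → x ∉ edge H e × y ∈ edge H e
    neither : ∃ λ e → x ∉ edge H e × y ∉ edge H e

NoShatteredPair : Hypergraph → Set
NoShatteredPair H = ∀ {x y} → x ≢ y → ¬ ShattersPair H x y

trace-≡ : ∀ {S E T : Subset N} → T ⊆ S → (∀ {z} → z ∈ S → z ∈ E → z ∈ T) →
          (∀ {z} → z ∈ T → z ∈ E) → S ∩ E ≡ T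
trace-≡ {S = S} {E} T⊆S from-E to-E = ⊆-antisym
  (λ z∈S∩E → from-E (proj₁ (x∈p∩q⁻ S E z∈S∩E)) (proj₂ (x∈p∩q⁻ S E z∈S∩E)))
  (λ z∈T → x∈p∩q⁺ (T⊆S z∈T , to-E z∈T))

Agree : Subset N → Subset N → Fin N → Set
Agree E T z = (z ∈ E → z ∈ T) × (z ∈ T → z ∈ E)

agree-in : ∀ {E T : Subset N} {z} → z ∈ E → z ∈ T → Agree E T z
agree-in z∈E z∈T = (λ _ → z∈T) , (λ _ → z∈E)

agree-out : ∀ {E T : Subset N} {z} → z ∉ E → z ∉ T → Agree E T z
agree-out z∉E z∉T = (λ z∈E → ⊥-elim (z∉E z∈E)) , (λ z∈T → ⊥-elim (z∉T z∈T))

matching-edge : ∀ {H x y} → ShattersPair H x y → ∀ T →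
                ∃ λ e → Agree (edge H e) T x × Agree (edge H e) T y
matching-edge {x = x} {y} sh T with x ∈? T | y ∈? T
... | yes x∈T | yes y∈T = let (e , x∈e , y∈e) = ShattersPair.both sh
                          in e , agree-in x∈e x∈T , agree-in y∈e y∈T
... | yes x∈T | no y∉T  = let (e , x∈e , y∉e) = ShattersPair.onlyˡ sh
                          in e , agree-in x∈e x∈T , agree-out y∉e y∉T
... | no x∉T  | yes y∈T = let (e , x∉e , y∈e) = ShattersPair.onlyʳ sh
                          in e , agree-out x∉e x∉T , agree-in y∈e y∈T
... | no x∉T  | no y∉T  = let (e , x∉e , y∉e) = ShattersPair.neither sh
                          in e , agree-out x∉e x∉T , agree-out y∉e y∉T

pair-members : ∀ {x y z : Fin N} → z ∈ ⁅ x ⁆ ∪ ⁅ y ⁆ → z ≡ x ⊎ z ≡ y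
pair-members {x = x} {y} z∈ with x∈p∪q⁻ ⁅ x ⁆ ⁅ y ⁆ z∈
... | inj₁ z∈⁅x⁆ = inj₁ (x∈⁅y⁆⇒x≡y x z∈⁅x⁆)
... | inj₂ z∈⁅y⁆ = inj₂ (x∈⁅y⁆⇒x≡y y z∈⁅y⁆)

shattered-pair : ∀ {H x y} → ShattersPair H x y → Shattered H (⁅ x ⁆ ∪ ⁅ y ⁆)
shattered-pair {H} {x} {y} sh T T⊆S with matching-edge sh T
... | e , agree-x , agree-y = e , trace-≡ T⊆S from-e to-e
  where
  from-e : ∀ {z} → z ∈ ⁅ x ⁆ ∪ ⁅ y ⁆ → z ∈ edge H e → z ∈ T
  from-e z∈S with pair-members z∈S
  ... | inj₁ refl = proj₁ agree-x
  ... | inj₂ refl = proj₁ agree-y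
  to-e : ∀ {z} → z ∈ T → z ∈ edge H e
  to-e z∈T with pair-members (T⊆S z∈T)
  ... | inj₁ refl = proj₂ agree-x z∈T
  ... | inj₂ refl = proj₂ agree-y z∈T

no-shattered-pair : ∀ {H} → VCdim H 1 → NoShatteredPair H
no-shattered-pair {H} (_ , bounded) {x} {y} x≢y sh =
  case ≤-trans two (bounded _ (shattered-pair sh)) of λ { (s≤s ()) }
  where
  two : 2 ≤ ∣ ⁅ x ⁆ ∪ ⁅ y ⁆ ∣
  two = two-elements (x∈p∪q⁺ (inj₁ (x∈⁅x⁆ x))) (x∈p∪q⁺ (inj₂ (x∈⁅x⁆ y))) x≢y

-- Part (i): polychromatic colourings

-- A minimal transversal meets no hyperedge in three vertices t₁, t₂, t₃:
-- the hyperedge and the private hyperedges of t₁, t₂, t₃ would realise all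
-- four traces of {t₁, t₂}.
transversals-never-crowded : ∀ H → NoShatteredPair H → Peeling.NeverCrowded (edge H)
transversals-never-crowded H no-pair d W T _ (_ , private-row) e (three , _)
  with ∈∩∩⁻ (edge H e) W T (Triple.x∈p three) | ∈∩∩⁻ (edge H e) W T (Triple.y∈p three)
     | ∈∩∩⁻ (edge H e) W T (Triple.z∈p three)
... | t₁∈e , t₁∈W , t₁∈T | t₂∈e , t₂∈W , t₂∈T | _ , _ , t₃∈T = no-pair t₁≢t₂ record
  { both    = e , t₁∈e , t₂∈e
  ; onlyˡ   = row π₁ , private-member π₁ , private-excludes π₁ t₂∈W t₂∈T (λ t₂≡t₁ → t₁≢t₂ (sym t₂≡t₁))
  ; onlyʳ   = row π₂ , private-excludes π₂ t₁∈W t₁∈T t₁≢t₂ , private-member π₂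
  ; neither = row π₃ , private-excludes π₃ t₁∈W t₁∈T t₁≢t₃ , private-excludes π₃ t₂∈W t₂∈T t₂≢t₃
  }
  where
  open Triple three renaming (x to t₁; y to t₂; z to t₃; x≢y to t₁≢t₂; x≢z to t₁≢t₃; y≢z to t₂≢t₃)
  open Hitting.PrivateRow using (row)
  open Peeling (edge H) using (restrict; private-member; private-excludes)
  π₁ : Hitting.PrivateRow (restrict W) T t₁
  π₁ = private-row t₁∈T
  π₂ : Hitting.PrivateRow (restrict W) T t₂
  π₂ = private-row t₂∈T
  π₃ : Hitting.PrivateRow (restrict W) T t₃
  π₃ = private-row t₃∈T

polychromatic-colouring : ∀ r H → NoShatteredPair H → EdgesAtLeast H (suc r) → HasPoly H ⌈ suc r /2⌉
polychromatic-colouring r H no-pair big = proj₁ colouring , polychromatic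
  where
  open Peeling (edge H)
  colouring : Σ (Fin (n H) → Fin ⌈ suc r /2⌉) (Rainbow ⊤)
  colouring = rainbow-colouring (peelable (transversals-never-crowded H no-pair)) r ⊤
    (λ e → subst (λ s → suc r ≤ ∣ s ∣) (sym (∩-identityʳ (edge H e))) (big e))
  polychromatic : Polychromatic H ⌈ suc r /2⌉ (proj₁ colouring)
  polychromatic e i with proj₂ colouring e i
  ... | v , v∈ , cv≡i = v , p∩q⊆p (edge H e) ⊤ v∈ , cv≡i

-- Part (ii): cover decompositions

star : (H : Hypergraph) → Fin (n H) → Subset (m H)
star H v = tabulate (λ e → lookup (edge H e) v)

∈star⁻ : ∀ H {v e} → e ∈ star H v → v ∈ edge H e
∈star⁻ H {v} {e} e∈star =
  lookup⇒[]= v (edge H e) (trans (sym (lookup∘tabulate (λ e → lookup (edge H e) v) e)) ([]=⇒lookup e∈star))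

∈star⁺ : ∀ H {v e} → v ∈ edge H e → e ∈ star H v
∈star⁺ H {v} {e} v∈e =
  lookup⇒[]= e (star H v) (trans (lookup∘tabulate (λ e → lookup (edge H e) v) e) ([]=⇒lookup v∈e))

separated : ∀ {E : Subset N} {x y} → x ∈ E → y ∉ E → x ≢ y
separated x∈E y∉E refl = y∉E x∈E

record CrowdedStar (H : Hypergraph) (v : Fin (n H)) : Set where
  field
    a b c e₁ e₂ : Fin (m H)
    pa pb       : Fin (n H)
    v∈a         : v ∈ edge H a
    v∈b         : v ∈ edge H b
    pa∈a        : pa ∈ edge H a
    pb∈b        : pb ∈ edge H b
    pa∉b        : pa ∉ edge H b
    pa∉c        : pa ∉ edge H c
    pb∉a        : pb ∉ edge H a
    pb∉c        : pb ∉ edge H c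
    pa∈e₁       : pa ∈ edge H e₁
    v∉e₁        : v ∉ edge H e₁
    pb∈e₂       : pb ∈ edge H e₂
    v∉e₂        : v ∉ edge H e₂

-- A crowded star shatters {v, pa} (via a, b, e₁, e₂) when pa ∉ e₂, and
-- {pa, pb} (via e₂, a, b, c) when pa ∈ e₂.
crowded-star-shatters : ∀ {H v} → CrowdedStar H v → ¬ NoShatteredPair H
crowded-star-shatters {H} {v} crowded no-pair = shattered (pa ∈? edge H e₂)
  where
  open CrowdedStar crowded
  shattered : Dec (pa ∈ edge H e₂) → ⊥
  shattered (no pa∉e₂) = no-pair (separated v∈b pa∉b) record
    { both = a , v∈a , pa∈a ; onlyˡ = b , v∈b , pa∉b ; onlyʳ = e₁ , v∉e₁ , pa∈e₁ ; neither = e₂ , v∉e₂ , pa∉e₂ }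
  shattered (yes pa∈e₂) = no-pair (separated pa∈a pb∉a) record
    { both = e₂ , pa∈e₂ , pb∈e₂ ; onlyˡ = a , pa∈a , pb∉a ; onlyʳ = b , pa∉b , pb∈b ; neither = c , pa∉c , pb∉c }

-- A minimal cover within A covers no sparse vertex three times: the private
-- vertices of two of the covering hyperedges, and hyperedges through them
-- escaping the sparse star, form a crowded star.
covers-never-crowded : ∀ H → NoShatteredPair H → Peeling.NeverCrowded (star H)
covers-never-crowded H no-pair d A C big (_ , private-row) v (three , sparse)
  with ∈∩∩⁻ (star H v) A C (Triple.x∈p three) | ∈∩∩⁻ (star H v) A C (Triple.y∈p three)
     | ∈∩∩⁻ (star H v) A C (Triple.z∈p three)
... | a∋v , a∈A , a∈C | b∋v , b∈A , b∈C | _ , c∈A , c∈C = crowded-star-shatters crowded no-pair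
  where
  open Triple three renaming (x to a; y to b; z to c; x≢y to a≢b; x≢z to a≢c; y≢z to b≢c)
  open Hitting.PrivateRow using (row)
  open Peeling (star H) using (restrict; private-member; private-excludes; private-row-escapes)
  πa : Hitting.PrivateRow (restrict A) C a
  πa = private-row a∈C
  πb : Hitting.PrivateRow (restrict A) C b
  πb = private-row b∈C
  escape₁ : ∃ λ e → e ∈ star H (row πa) × e ∉ star H v
  escape₁ = private-row-escapes big πa sparse
  escape₂ : ∃ λ e → e ∈ star H (row πb) × e ∉ star H v
  escape₂ = private-row-escapes big πb sparse
  crowded : CrowdedStar H v
  crowded = record
    { a = a ; b = b ; c = c ; e₁ = proj₁ escape₁ ; e₂ = proj₁ escape₂ ; pa = row πa ; pb = row πb
    ; v∈a = ∈star⁻ H a∋v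
    ; v∈b = ∈star⁻ H b∋v
    ; pa∈a = ∈star⁻ H (private-member πa)
    ; pb∈b = ∈star⁻ H (private-member πb)
    ; pa∉b = λ pa∈b → private-excludes πa b∈A b∈C (λ b≡a → a≢b (sym b≡a)) (∈star⁺ H pa∈b)
    ; pa∉c = λ pa∈c → private-excludes πa c∈A c∈C (λ c≡a → a≢c (sym c≡a)) (∈star⁺ H pa∈c)
    ; pb∉a = λ pb∈a → private-excludes πb a∈A a∈C a≢b (∈star⁺ H pb∈a)
    ; pb∉c = λ pb∈c → private-excludes πb c∈A c∈C (λ c≡b → b≢c (sym c≡b)) (∈star⁺ H pb∈c)
    ; pa∈e₁ = ∈star⁻ H (proj₁ (proj₂ escape₁))
    ; v∉e₁ = λ v∈e₁ → proj₂ (proj₂ escape₁) (∈star⁺ H v∈e₁)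
    ; pb∈e₂ = ∈star⁻ H (proj₁ (proj₂ escape₂))
    ; v∉e₂ = λ v∈e₂ → proj₂ (proj₂ escape₂) (∈star⁺ H v∈e₂)
    }

cover-partition : ∀ δ H → NoShatteredPair H → MinDegAtLeast H (suc δ) → HasCoverPartition H ⌈ suc δ /2⌉
cover-partition δ H no-pair big = proj₁ colouring , partition
  where
  open Peeling (star H)
  colouring : Σ (Fin (m H) → Fin ⌈ suc δ /2⌉) (Rainbow ⊤)
  colouring = rainbow-colouring (peelable (covers-never-crowded H no-pair)) δ ⊤
    (λ v → subst (λ s → suc δ ≤ ∣ s ∣) (sym (∩-identityʳ (star H v))) (big v))
  partition : CoverPartition H ⌈ suc δ /2⌉ (proj₁ colouring)
  partition i v with proj₂ colouring v i
  ... | e , e∈ , ce≡i = e , ce≡i , ∈star⁻ H (p∩q⊆p (star H v) ⊤ e∈)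

-- The extremal example

coSingletons : ℕ → Hypergraph
coSingletons r = hypergraph (suc r) (suc r) (λ e → ∁ ⁅ e ⁆)

∈∁⁅⁆⁻ : ∀ {x y : Fin N} → y ∈ ∁ ⁅ x ⁆ → y ≢ x
∈∁⁅⁆⁻ y∈ = x∉⁅y⁆⇒x≢y (x∈∁p⇒x∉p y∈)

∈∁⁅⁆⁺ : ∀ {x y : Fin N} → y ≢ x → y ∈ ∁ ⁅ x ⁆
∈∁⁅⁆⁺ y≢x = x∉p⇒x∈∁p (x≢y⇒x∉⁅y⁆ y≢x)

∣∁⁅x⁆∣≡r : ∀ {r} (x : Fin (suc r)) → ∣ ∁ ⁅ x ⁆ ∣ ≡ r
∣∁⁅x⁆∣≡r {r} x = trans (∣∁p∣≡n∸∣p∣ ⁅ x ⁆) (cong (suc r ∸_) (∣⁅x⁆∣≡1 x))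

coSingletons-star : ∀ r v → star (coSingletons r) v ≡ ∁ ⁅ v ⁆
coSingletons-star r v = ⊆-antisym
  (λ e∈ → ∈∁⁅⁆⁺ (λ e≡v → ∈∁⁅⁆⁻ (∈star⁻ (coSingletons r) e∈) (sym e≡v)))
  (λ e∈ → ∈star⁺ (coSingletons r) (∈∁⁅⁆⁺ (λ v≡e → ∈∁⁅⁆⁻ e∈ (sym v≡e))))

coSingletons-vc : ∀ r → VCdim (coSingletons (suc r)) 1
coSingletons-vc r = (⁅ zero ⁆ , singleton-shattered , ∣⁅x⁆∣≡1 (zero {suc r})) , shattered-small
  where
  H : Hypergraph
  H = coSingletons (suc r)
  -- {0} has the traces {0} (on ∁{1}) and ∅ (on ∁{0}).
  singleton-shattered : Shattered H ⁅ zero ⁆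
  singleton-shattered T T⊆S with zero ∈? T
  ... | yes 0∈T = suc zero , trace-≡ T⊆S
    (λ z∈S _ → subst (_∈ T) (sym (x∈⁅y⁆⇒x≡y zero z∈S)) 0∈T)
    (λ z∈T → ∈∁⁅⁆⁺ {x = suc zero} (λ z≡1 → 0≢1+n (trans (sym (x∈⁅y⁆⇒x≡y zero (T⊆S z∈T))) z≡1)))
  ... | no 0∉T = zero , trace-≡ T⊆S
    (λ z∈S z∈E → ⊥-elim (∈∁⁅⁆⁻ z∈E (x∈⁅y⁆⇒x≡y zero z∈S)))
    (λ z∈T → ⊥-elim (0∉T (subst (_∈ T) (x∈⁅y⁆⇒x≡y zero (T⊆S z∈T)) z∈T)))
  -- A shattered set S has the empty trace on some ∁{e}, so S ⊆ {e}.
  shattered-small : ∀ S → Shattered H S → ∣ S ∣ ≤ 1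
  shattered-small S shattered with shattered ∅ ⊥⊆
  ... | e , S∩E≡∅ = ≤-trans (p⊆q⇒∣p∣≤∣q∣ S⊆⁅e⁆) (≤-reflexive (∣⁅x⁆∣≡1 e))
    where
    S⊆⁅e⁆ : S ⊆ ⁅ e ⁆
    S⊆⁅e⁆ {z} z∈S with z ≟ e
    ... | yes refl = x∈⁅x⁆ e
    ... | no z≢e = ⊥-elim (∉⊥ (subst (z ∈_) S∩E≡∅ (x∈p∩q⁺ (z∈S , ∈∁⁅⁆⁺ z≢e))))

-- If every class of g has an element besides any given point, then every
-- class has two elements, so g has at most half as many classes as points.
two-per-class : ∀ {N k} (g : Fin N → Fin k) → Fin N →
                (∀ i x → ∃ λ y → y ≢ x × g y ≡ i) → k + k ≤ N
two-per-class {N} {k} g x₀ avoid = injective⇒≤ {f = λ z → pick (splitAt k z)} injective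
  where
  first second : Fin k → Fin N
  first i = proj₁ (avoid i x₀)
  second i = proj₁ (avoid i (first i))
  pick : Fin k ⊎ Fin k → Fin N
  pick = [ first , second ]′
  class : Fin k ⊎ Fin k → Fin k
  class = [ id , id ]′
  g∘pick : ∀ u → g (pick u) ≡ class u
  g∘pick (inj₁ i) = proj₂ (proj₂ (avoid i x₀))
  g∘pick (inj₂ i) = proj₂ (proj₂ (avoid i (first i)))
  same-class : ∀ u w → pick u ≡ pick w → class u ≡ class w
  same-class u w eq = trans (sym (g∘pick u)) (trans (cong g eq) (g∘pick w))
  second≢first : ∀ i → second i ≢ first i
  second≢first i = proj₁ (proj₂ (avoid i (first i)))
  pick-injective : ∀ u w → pick u ≡ pick w → u ≡ w
  pick-injective (inj₁ i) (inj₁ j) eq = cong inj₁ (same-class (inj₁ i) (inj₁ j) eq)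
  pick-injective (inj₂ i) (inj₂ j) eq = cong inj₂ (same-class (inj₂ i) (inj₂ j) eq)
  pick-injective (inj₁ i) (inj₂ j) eq with same-class (inj₁ i) (inj₂ j) eq
  ... | refl = ⊥-elim (second≢first i (sym eq))
  pick-injective (inj₂ i) (inj₁ j) eq with same-class (inj₂ i) (inj₁ j) eq
  ... | refl = ⊥-elim (second≢first i eq)
  injective : ∀ {z z′} → pick (splitAt k z) ≡ pick (splitAt k z′) → z ≡ z′
  injective {z} {z′} eq = trans (sym (join-splitAt k k z))
    (trans (cong (join k k) (pick-injective (splitAt k z) (splitAt k z′) eq)) (join-splitAt k k z′))

at-most-half : ∀ {k r} → k + k ≤ suc r → k ≤ ⌈ r /2⌉
at-most-half {k} k+k≤ = subst (_≤ _) (sym (n≡⌊n+n/2⌋ k)) (⌊n/2⌋-mono k+k≤)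

-- Every colour of a polychromatic colouring lies in ∁{x} for every x.
coSingletons-poly-bound : ∀ r k → HasPoly (coSingletons r) k → k ≤ ⌈ r /2⌉
coSingletons-poly-bound r k (c , poly) = at-most-half (two-per-class c zero λ i x →
  let (v , v∈ , cv≡i) = poly x i in v , ∈∁⁅⁆⁻ v∈ , cv≡i)

-- Every cover of a cover partition contains some ∁{e} with e ≢ x, for every x.
coSingletons-cover-bound : ∀ r k → HasCoverPartition (coSingletons r) k → k ≤ ⌈ r /2⌉
coSingletons-cover-bound r k (f , covers) = at-most-half (two-per-class f zero λ i x →
  let (e , fe≡i , x∈e) = covers i x in e , (λ e≡x → ∈∁⁅⁆⁻ x∈e (sym e≡x)) , fe≡i)

part-i : ∀ (r : ℕ) → 1 ≤ r →
  (∀ (H : Hypergraph) → VCdim H 1 → EdgesAtLeast H r → pAtLeast H ⌈ r /2⌉)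
  × (∃ λ (H : Hypergraph) → VCdim H 1 × EdgesAtLeast H r × pEquals H ⌈ r /2⌉)
part-i (suc r) _ =
  (λ H vc big → _ , ≤-refl , polychromatic-colouring r H (no-shattered-pair vc) big) ,
  coSingletons (suc r) , coSingletons-vc r , sizes ,
  polychromatic-colouring r _ (no-shattered-pair (coSingletons-vc r)) sizes ,
  coSingletons-poly-bound (suc r)
  where
  sizes : EdgesAtLeast (coSingletons (suc r)) (suc r)
  sizes e = ≤-reflexive (sym (∣∁⁅x⁆∣≡r e))

part-ii : ∀ (δ : ℕ) → 1 ≤ δ →
  (∀ (H : Hypergraph) → VCdim H 1 → MinDegAtLeast H δ → p'AtLeast H ⌈ δ /2⌉)
  × (∃ λ (H : Hypergraph) → VCdim H 1 × MinDegAtLeast H δ × p'Equals H ⌈ δ /2⌉)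
part-ii (suc δ) _ =
  (λ H vc big → _ , ≤-refl , cover-partition δ H (no-shattered-pair vc) big) ,
  coSingletons (suc δ) , coSingletons-vc δ , degrees ,
  cover-partition δ _ (no-shattered-pair (coSingletons-vc δ)) degrees ,
  coSingletons-cover-bound (suc δ)
  where
  degrees : MinDegAtLeast (coSingletons (suc δ)) (suc δ)
  degrees v = ≤-reflexive (sym (trans (cong ∣_∣ (coSingletons-star (suc δ) v)) (∣∁⁅x⁆∣≡r v)))

theorem6 : (∀ (r : ℕ) → 1 ≤ r →
    (∀ (H : Hypergraph) → VCdim H 1 → EdgesAtLeast H r → pAtLeast H ⌈ r /2⌉)
    × (∃ λ (H : Hypergraph) → VCdim H 1 × EdgesAtLeast H r × pEquals H ⌈ r /2⌉))
    × (∀ (δ : ℕ) → 1 ≤ δ →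
    (∀ (H : Hypergraph) → VCdim H 1 → MinDegAtLeast H δ → p'AtLeast H ⌈ δ /2⌉)
    × (∃ λ (H : Hypergraph) → VCdim H 1 × MinDegAtLeast H δ × p'Equals H ⌈ δ /2⌉))
theorem6 = part-i , part-ii
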